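{- For $n\ge0$ let $P_n(y)=\sum_{\pi\in\mathrm{UPF}(n)}y^{\#\{i:\ \text{car } i \text{ has displacement } 1\}}$, so $P_0(y)=1$. Then for $n\ge1$, $$P_n(y)=(y+1)\sum_{i=0}^{n-1}\binom{n-1}{i}P_i(y)P_{n-i-1}(y)-yP_{n-1}(y).$$
   Context: Classical parking: spots $1,\dots,n$, cars $1,\dots,n$ arrive in order with preferences $\pi=(\pi_1,\dots,\pi_n)$, and car $i$ parks in the first unoccupied spot among $\pi_i,\pi_i+1,\dots,n$; $\pi$ is a parking function if all cars park. The displacement of car $i$ is (spot where it parks) $-\pi_i$. $\mathrm{UPF}(n)$, the set of unit interval parking functions of length $n$, consists of the parking functions of length $n$ in which every car has displacement at most $1$. -}

module Defs where

open import Data.Nat as ℕ using (ℕ; zero; suc; _∸_; _≡ᵇ_; _≤ᵇ_)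
open import Data.Bool using (Bool; true; false; if_then_else_; _∧_)
open import Data.List using (List; []; _∷_; map; concatMap; upTo; replicate; length)
open import Data.Maybe using (Maybe; just; nothing)
open import Data.Product using (_×_; _,_)
open import Data.Integer as ℤ using (ℤ; +_)

-- Spots are 0,…,n-1 (0-based), preferences are naturals < n (0-based).
-- Occupancy is a list of Booleans (true = occupied), indexed by spot.

park : List Bool → ℕ → Maybe (ℕ × List Bool)
park [] _ = nothing
park (b ∷ occ) (suc p) with park occ p
... | nothing = nothing
... | just (s , occ') = just (suc s , b ∷ occ')
park (true ∷ occ) zero with park occ zero
... | nothing = nothing
... | just (s , occ') = just (suc s , true ∷ occ')
park (false ∷ occ) zero = just (zero , true ∷ occ)

run : List Bool → List ℕ → Maybe (List ℕ)
run occ [] = just []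
run occ (p ∷ ps) with park occ p
... | nothing = nothing
... | just (s , occ') with run occ' ps
...   | nothing = nothing
...   | just ds = just ((s ∸ p) ∷ ds)

displacements : ℕ → List ℕ → Maybe (List ℕ)
displacements n π = run (replicate n false) π

allLe1 : List ℕ → Bool
allLe1 [] = true
allLe1 (d ∷ ds) = (d ≤ᵇ 1) ∧ allLe1 ds

count1 : List ℕ → ℕ
count1 [] = 0
count1 (d ∷ ds) = if d ≡ᵇ 1 then suc (count1 ds) else count1 ds

seqs : ℕ → ℕ → List (List ℕ)
seqs n zero = [] ∷ []
seqs n (suc k) = concatMap (λ p → map (p ∷_) (seqs n k)) (upTo n)

sumℤ : List ℤ → ℤ
sumℤ [] = + 0
sumℤ (x ∷ xs) = x ℤ.+ sumℤ xs

-- weight of π: y^(#cars with displacement 1) if π ∈ UPF(n), else 0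
weight : ℕ → ℤ → List ℕ → ℤ
weight n y π with displacements n π
... | nothing = + 0
... | just ds = if allLe1 ds then y ℤ.^ count1 ds else + 0

P : ℕ → ℤ → ℤ
P n y = sumℤ (map (weight n y) (seqs n n))

-- Let completions k occ be the weighted number of ways for k more cars to
-- park with displacement at most 1 on a partly filled board occ: a car taking
-- a free spot f weighs 1 + y if spot f - 1 is occupied (it may have preferred
-- f or f - 1) and 1 otherwise. Summing over the first car's preference gives
-- P n y = completions n (empty n).
-- Now classify by the spot e filled last. That car weighs 1 if e = 0 and
-- 1 + y otherwise, and before it arrives the e spots to its left and the
-- n - e spots to its right fill independently, in C(n, e) interleavings; so
-- P (n + 1) = P n + (1 + y) Σ_{e ≥ 1} C(n, e) P e P (n - e), the recurrence.
-- The independence is proved by induction on the number of cars: the first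
-- car goes left or right, and Pascal's rule merges the two cases.

module Submission where

open import Defs
open import Data.Nat using (ℕ; suc; _∸_)
open import Data.Nat.Combinatorics using (_C_)
open import Data.List using (map; upTo)
open import Data.Integer using (ℤ; +_; _+_; _*_; _-_)
open import Relation.Binary.PropositionalEquality using (_≡_)

open import Data.Bool using (Bool; true; false; if_then_else_)
open import Data.Empty using (⊥-elim)
open import Data.Fin using (toℕ)
open import Data.Fin.Properties using (toℕ<n)
open import Data.Integer using (_^_)
open import Data.Integer.Tactic.RingSolver using (solve-∀)
open import Data.List using (List; []; _∷_; concat; concatMap; applyUpTo; replicate; length; take; drop; _++_)
open import Data.Maybe using (Maybe; just; nothing)
open import Data.Nat as ℕ using (zero; _≤_; _<_; z≤n; s≤s)
open import Data.Nat.Combinatorics using (nCn≡1; nCk+nC[k+1]≡[n+1]C[k+1])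
open import Data.Product using (_×_; _,_)
open import Function using (_∘_)
open import Relation.Binary.PropositionalEquality
  using (refl; sym; trans; cong; cong₂; _≢_; module ≡-Reasoning)

import Data.Integer.Properties as ℤ
import Data.List.Properties as List
import Data.Nat.Properties as ℕ

open import Algebra.Properties.Semiring.Sum ℤ.+-*-semiring
  using (sum; sum-cong-≗; sum-replicate-zero; ∑-distrib-+; ∑-comm; *-distribˡ-sum)

∑< : ℕ → (ℕ → ℤ) → ℤ
∑< m X = sum {m} (X ∘ toℕ)

∑<-cong : ∀ m {X Y : ℕ → ℤ} → (∀ i → i < m → X i ≡ Y i) → ∑< m X ≡ ∑< m Y
∑<-cong m X≡Y = sum-cong-≗ (λ i → X≡Y (toℕ i) (toℕ<n i))

∑<-cong′ : ∀ m {X Y : ℕ → ℤ} → (∀ i → X i ≡ Y i) → ∑< m X ≡ ∑< m Y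
∑<-cong′ m X≡Y = ∑<-cong m (λ i _ → X≡Y i)

∑<-zero : ∀ m → ∑< m (λ _ → + 0) ≡ + 0
∑<-zero = sum-replicate-zero

∑<-distrib-+ : ∀ m (X Y : ℕ → ℤ) → ∑< m (λ i → X i + Y i) ≡ ∑< m X + ∑< m Y
∑<-distrib-+ m X Y = ∑-distrib-+ {m} (X ∘ toℕ) (Y ∘ toℕ)

*-distribˡ-∑< : ∀ m c (X : ℕ → ℤ) → c * ∑< m X ≡ ∑< m (λ i → c * X i)
*-distribˡ-∑< m c X = *-distribˡ-sum {m} c (X ∘ toℕ)

∑<-comm : ∀ m n (X : ℕ → ℕ → ℤ) → ∑< m (λ i → ∑< n (X i)) ≡ ∑< n (λ j → ∑< m (λ i → X i j))
∑<-comm m n X = ∑-comm {m} {n} (λ i j → X (toℕ i) (toℕ j))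

∑<-last : ∀ m (X : ℕ → ℤ) → ∑< (suc m) X ≡ ∑< m X + X m
∑<-last zero X = trans (ℤ.+-identityʳ (X 0)) (sym (ℤ.+-identityˡ (X 0)))
∑<-last (suc m) X = trans (cong (_+_ (X 0)) (∑<-last m (X ∘ suc))) (sym (ℤ.+-assoc (X 0) _ _))

∑<-around : ∀ m n (X : ℕ → ℤ) →
  ∑< (m ℕ.+ suc n) X ≡ ∑< m X + (X m + ∑< n (λ i → X (suc m ℕ.+ i)))
∑<-around zero n X = sym (ℤ.+-identityˡ _)
∑<-around (suc m) n X = trans (cong (_+_ (X 0)) (∑<-around m n (X ∘ suc))) (sym (ℤ.+-assoc (X 0) _ _))

shiftRight : (ℕ → ℤ) → ℕ → ℤ
shiftRight X zero = + 0
shiftRight X (suc i) = X i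

∑<-shiftRight : ∀ m (X : ℕ → ℤ) → X m ≡ + 0 → ∑< (suc m) (shiftRight X) ≡ ∑< (suc m) X
∑<-shiftRight m X Xm≡0 = begin
  + 0 + ∑< m X    ≡⟨ ℤ.+-identityˡ _ ⟩
  ∑< m X          ≡⟨ sym (ℤ.+-identityʳ _) ⟩
  ∑< m X + + 0    ≡⟨ cong (_+_ (∑< m X)) (sym Xm≡0) ⟩
  ∑< m X + X m    ≡⟨ sym (∑<-last m X) ⟩
  ∑< (suc m) X    ∎
  where open ≡-Reasoning

sumℤ-++ : ∀ (xs ys : List ℤ) → sumℤ (xs ++ ys) ≡ sumℤ xs + sumℤ ys
sumℤ-++ [] ys = sym (ℤ.+-identityˡ _)
sumℤ-++ (x ∷ xs) ys = trans (cong (_+_ x) (sumℤ-++ xs ys)) (sym (ℤ.+-assoc x _ _))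

sumℤ-concat : ∀ (xss : List (List ℤ)) → sumℤ (concat xss) ≡ sumℤ (map sumℤ xss)
sumℤ-concat [] = refl
sumℤ-concat (xs ∷ xss) = trans (sumℤ-++ xs (concat xss)) (cong (_+_ (sumℤ xs)) (sumℤ-concat xss))

sumℤ-applyUpTo : ∀ (X : ℕ → ℤ) m → sumℤ (applyUpTo X m) ≡ ∑< m X
sumℤ-applyUpTo X zero = refl
sumℤ-applyUpTo X (suc m) = cong (_+_ (X 0)) (sumℤ-applyUpTo (X ∘ suc) m)

sumℤ-map-upTo : ∀ (X : ℕ → ℤ) m → sumℤ (map X (upTo m)) ≡ ∑< m X
sumℤ-map-upTo X m = trans (cong sumℤ (List.map-applyUpTo (λ i → i) X m)) (sumℤ-applyUpTo X m)

module _ {A : Set} where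

  sumℤ-map-cong : ∀ {F G : A → ℤ} → (∀ x → F x ≡ G x) → ∀ xs → sumℤ (map F xs) ≡ sumℤ (map G xs)
  sumℤ-map-cong F≡G xs = cong sumℤ (List.map-cong F≡G xs)

  sumℤ-map-zero : ∀ (xs : List A) → sumℤ (map (λ _ → + 0) xs) ≡ + 0
  sumℤ-map-zero [] = refl
  sumℤ-map-zero (x ∷ xs) = trans (ℤ.+-identityˡ _) (sumℤ-map-zero xs)

  *-distribˡ-sumℤ-map : ∀ c (F : A → ℤ) xs → c * sumℤ (map F xs) ≡ sumℤ (map (λ x → c * F x) xs)
  *-distribˡ-sumℤ-map c F [] = ℤ.*-zeroʳ c
  *-distribˡ-sumℤ-map c F (x ∷ xs) =
    trans (ℤ.*-distribˡ-+ c (F x) _) (cong (_+_ (c * F x)) (*-distribˡ-sumℤ-map c F xs))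

sumℤ-seqs-suc : ∀ (F : List ℕ → ℤ) m k →
  sumℤ (map F (seqs m (suc k))) ≡ ∑< m (λ p → sumℤ (map (F ∘ (p ∷_)) (seqs m k)))
sumℤ-seqs-suc F m k = begin
  sumℤ (map F (concatMap G (upTo m)))            ≡⟨ cong sumℤ (List.map-concatMap F G (upTo m)) ⟩
  sumℤ (concat (map (map F ∘ G) (upTo m)))       ≡⟨ sumℤ-concat (map (map F ∘ G) (upTo m)) ⟩
  sumℤ (map sumℤ (map (map F ∘ G) (upTo m)))     ≡⟨ cong sumℤ (sym (List.map-∘ (upTo m))) ⟩
  sumℤ (map (sumℤ ∘ map F ∘ G) (upTo m))         ≡⟨ sumℤ-map-upTo (sumℤ ∘ map F ∘ G) m ⟩
  ∑< m (sumℤ ∘ map F ∘ G)                        ≡⟨ ∑<-cong′ m (λ p → cong sumℤ (sym (List.map-∘ {f = p ∷_} (seqs m k)))) ⟩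
  ∑< m (λ p → sumℤ (map (F ∘ (p ∷_)) (seqs m k))) ∎
  where
  open ≡-Reasoning
  G : ℕ → List (List ℕ)
  G p = map (p ∷_) (seqs m k)

Board : Set
Board = List Bool

infixl 10 _!_

-- Spots beyond the end of the board count as occupied.
_!_ : Board → ℕ → Bool
[] ! _ = true
(b ∷ _) ! zero = b
(_ ∷ bs) ! suc i = bs ! i

fill : Board → ℕ → Board
fill [] _ = []
fill (_ ∷ bs) zero = true ∷ bs
fill (b ∷ bs) (suc i) = b ∷ fill bs i

#free : Board → ℕ
#free [] = 0
#free (false ∷ bs) = suc (#free bs)
#free (true ∷ bs) = #free bs

empty : ℕ → Board
empty n = replicate n false

length-fill : ∀ occ f → length (fill occ f) ≡ length occ
length-fill [] f = refl
length-fill (b ∷ bs) zero = refl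
length-fill (b ∷ bs) (suc f) = cong suc (length-fill bs f)

fill-!-same : ∀ occ f → fill occ f ! f ≡ true
fill-!-same [] f = refl
fill-!-same (b ∷ bs) zero = refl
fill-!-same (b ∷ bs) (suc f) = fill-!-same bs f

fill-!-other : ∀ occ {f e} → f ≢ e → fill occ f ! e ≡ occ ! e
fill-!-other [] f≢e = refl
fill-!-other (b ∷ bs) {zero} {zero} f≢e = ⊥-elim (f≢e refl)
fill-!-other (b ∷ bs) {zero} {suc e} f≢e = refl
fill-!-other (b ∷ bs) {suc f} {zero} f≢e = refl
fill-!-other (b ∷ bs) {suc f} {suc e} f≢e = fill-!-other bs (f≢e ∘ cong suc)

fill-!-occupied : ∀ occ f {e} → occ ! e ≡ true → fill occ f ! e ≡ true
fill-!-occupied [] f e-occ = refl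
fill-!-occupied (b ∷ bs) zero {zero} e-occ = refl
fill-!-occupied (b ∷ bs) zero {suc e} e-occ = e-occ
fill-!-occupied (b ∷ bs) (suc f) {zero} e-occ = e-occ
fill-!-occupied (b ∷ bs) (suc f) {suc e} e-occ = fill-!-occupied bs f e-occ

#free-fill : ∀ occ {f} → occ ! f ≡ false → #free occ ≡ suc (#free (fill occ f))
#free-fill (false ∷ bs) {zero} f-free = refl
#free-fill (false ∷ bs) {suc f} f-free = cong suc (#free-fill bs f-free)
#free-fill (true ∷ bs) {suc f} f-free = #free-fill bs f-free

#free≡0⇒occupied : ∀ occ {i} → #free occ ≡ 0 → occ ! i ≡ true
#free≡0⇒occupied [] full = refl
#free≡0⇒occupied (true ∷ bs) {zero} full = refl
#free≡0⇒occupied (true ∷ bs) {suc i} full = #free≡0⇒occupied bs full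

!-beyond : ∀ occ {i} → length occ ≤ i → occ ! i ≡ true
!-beyond [] _ = refl
!-beyond (b ∷ bs) (s≤s len≤i) = !-beyond bs len≤i

!-occupied≢free : ∀ occ {i j} → occ ! i ≡ true → occ ! j ≡ false → i ≢ j
!-occupied≢free occ i-occ j-free refl with trans (sym i-occ) j-free
... | ()

free⇒<length : ∀ occ {i} → occ ! i ≡ false → i < length occ
free⇒<length (b ∷ bs) {zero} i-free = s≤s z≤n
free⇒<length (b ∷ bs) {suc i} i-free = s≤s (free⇒<length bs i-free)

take-! : ∀ occ {e f} → f < e → take e occ ! f ≡ occ ! f
take-! [] {suc e} f<e = refl
take-! (b ∷ bs) {suc e} {zero} f<e = refl
take-! (b ∷ bs) {suc e} {suc f} (s≤s f<e) = take-! bs f<e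

drop-! : ∀ occ e g → drop (suc e) occ ! g ≡ occ ! (suc e ℕ.+ g)
drop-! [] e g = refl
drop-! (b ∷ bs) zero g = refl
drop-! (b ∷ bs) (suc e) g = drop-! bs e g

take-fill-< : ∀ occ {e f} → f < e → take e (fill occ f) ≡ fill (take e occ) f
take-fill-< [] {suc e} f<e = refl
take-fill-< (b ∷ bs) {suc e} {zero} f<e = refl
take-fill-< (b ∷ bs) {suc e} {suc f} (s≤s f<e) = cong (b ∷_) (take-fill-< bs f<e)

drop-fill-≤ : ∀ occ {e f} → f ≤ e → drop (suc e) (fill occ f) ≡ drop (suc e) occ
drop-fill-≤ [] f≤e = refl
drop-fill-≤ (b ∷ bs) {e} {zero} f≤e = refl
drop-fill-≤ (b ∷ bs) {suc e} {suc f} (s≤s f≤e) = drop-fill-≤ bs f≤e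

take-fill-≥ : ∀ occ {e f} → e ≤ f → take e (fill occ f) ≡ take e occ
take-fill-≥ [] e≤f = refl
take-fill-≥ (b ∷ bs) {zero} e≤f = refl
take-fill-≥ (b ∷ bs) {suc e} {suc f} (s≤s e≤f) = cong (b ∷_) (take-fill-≥ bs e≤f)

drop-fill-> : ∀ occ e g → drop (suc e) (fill occ (suc e ℕ.+ g)) ≡ fill (drop (suc e) occ) g
drop-fill-> [] e g = refl
drop-fill-> (b ∷ bs) zero g = refl
drop-fill-> (b ∷ bs) (suc e) g = drop-fill-> bs e g

#free-split : ∀ occ {e} → occ ! e ≡ false → #free occ ≡ suc (#free (take e occ) ℕ.+ #free (drop (suc e) occ))
#free-split (false ∷ bs) {zero} e-free = refl
#free-split (false ∷ bs) {suc e} e-free = cong suc (#free-split bs e-free)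
#free-split (true ∷ bs) {suc e} e-free = #free-split bs e-free

length-take-≤ : ∀ (occ : Board) {e} → e ≤ length occ → length (take e occ) ≡ e
length-take-≤ occ {e} e≤len = trans (List.length-take e occ) (ℕ.m≤n⇒m⊓n≡m e≤len)

length-around : ∀ (occ : Board) {e} → e < length occ → length occ ≡ e ℕ.+ suc (length (drop (suc e) occ))
length-around occ {e} e<len = sym (begin
  e ℕ.+ suc (length (drop (suc e) occ))   ≡⟨ cong (λ r → e ℕ.+ suc r) (List.length-drop (suc e) occ) ⟩
  e ℕ.+ suc (length occ ∸ suc e)          ≡⟨ ℕ.+-suc e _ ⟩
  suc e ℕ.+ (length occ ∸ suc e)          ≡⟨ ℕ.m+[n∸m]≡n e<len ⟩
  length occ                              ∎)
  where open ≡-Reasoning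

empty-! : ∀ {n e} → e < n → empty n ! e ≡ false
empty-! {suc n} {zero} e<n = refl
empty-! {suc n} {suc e} (s≤s e<n) = empty-! e<n

take-empty : ∀ {n e} → e ≤ n → take e (empty n) ≡ empty e
take-empty {n} {zero} e≤n = refl
take-empty {suc n} {suc e} (s≤s e≤n) = cong (false ∷_) (take-empty e≤n)

drop-empty : ∀ n e → drop e (empty n) ≡ empty (n ∸ e)
drop-empty n zero = refl
drop-empty zero (suc e) = refl
drop-empty (suc n) (suc e) = drop-empty n e

#free-empty : ∀ n → #free (empty n) ≡ n
#free-empty zero = refl
#free-empty (suc n) = cong suc (#free-empty n)

park-free : ∀ occ {p} → occ ! p ≡ false → park occ p ≡ just (p , fill occ p)
park-free (false ∷ bs) {zero} p-free = refl
park-free (b ∷ bs) {suc p} p-free rewrite park-free bs p-free = refl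

park-next : ∀ occ {p} → occ ! p ≡ true → occ ! suc p ≡ false → park occ p ≡ just (suc p , fill occ (suc p))
park-next (true ∷ bs) {zero} p-occ p+1-free rewrite park-free bs p+1-free = refl
park-next (b ∷ bs) {suc p} p-occ p+1-free rewrite park-next bs p-occ p+1-free = refl

park-spec : ∀ occ p {s o} → park occ p ≡ just (s , o) →
  occ ! s ≡ false × p ≤ s × length o ≡ length occ
park-spec (false ∷ bs) zero refl = refl , z≤n , refl
park-spec (true ∷ bs) zero eq with park bs zero in eq′
park-spec (true ∷ bs) zero refl | just (s , o) with park-spec bs zero eq′
... | s-free , _ , len = s-free , z≤n , cong suc len
park-spec (b ∷ bs) (suc p) eq with park bs p in eq′
park-spec (b ∷ bs) (suc p) refl | just (s , o) with park-spec bs p eq′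
... | s-free , p≤s , len = s-free , s≤s p≤s , cong suc len

-- Weighted completions of a partly filled board

whenFree : Bool → ℤ → ℤ
whenFree true _ = + 0
whenFree false x = x

whenFree-occupied : ∀ {b} x → b ≡ true → whenFree b x ≡ + 0
whenFree-occupied x refl = refl

whenFree-cong : ∀ b {x x′} → (b ≡ false → x ≡ x′) → whenFree b x ≡ whenFree b x′
whenFree-cong true _ = refl
whenFree-cong false x≡x′ = x≡x′ refl

*-whenFree-zero : ∀ b c → whenFree b (c * + 0) ≡ + 0
*-whenFree-zero true c = refl
*-whenFree-zero false c = ℤ.*-zeroʳ c

*-distribˡ-whenFree : ∀ b c x → c * whenFree b x ≡ whenFree b (c * x)
*-distribˡ-whenFree true c x = ℤ.*-zeroʳ c
*-distribˡ-whenFree false c x = refl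

whenFree-free : ∀ {b} x → b ≡ false → whenFree b x ≡ x
whenFree-free x refl = refl

whenFree-∑< : ∀ b m (X : ℕ → ℤ) → whenFree b (∑< m X) ≡ ∑< m (λ i → whenFree b (X i))
whenFree-∑< true m X = sym (∑<-zero m)
whenFree-∑< false m X = refl

whenFree²-*-swap : ∀ a b c d x → whenFree a (c * whenFree b (d * x)) ≡ d * whenFree a (whenFree b (c * x))
whenFree²-*-swap true b c d x = sym (ℤ.*-zeroʳ d)
whenFree²-*-swap false true c d x = trans (ℤ.*-zeroʳ c) (sym (ℤ.*-zeroʳ d))
whenFree²-*-swap false false c d x = swap c d x
  where
  swap : ∀ c d x → c * (d * x) ≡ d * (c * x)
  swap = solve-∀

∑<-whenFree-full : ∀ occ m (X : ℕ → ℤ) → #free occ ≡ 0 → ∑< m (λ i → whenFree (occ ! i) (X i)) ≡ + 0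
∑<-whenFree-full occ m X full =
  trans (∑<-cong′ m (λ i → whenFree-occupied (X i) (#free≡0⇒occupied occ {i} full))) (∑<-zero m)

module Weighted (y : ℤ) where

  displacementWeight : ℕ → ℤ
  displacementWeight 0 = + 1
  displacementWeight 1 = y
  displacementWeight (suc (suc _)) = + 0

  runWeight : Maybe (List ℕ) → ℤ
  runWeight nothing = + 0
  runWeight (just ds) = if allLe1 ds then y ^ count1 ds else + 0

  displacementWeight-far : ∀ {p s} → p ≤ s → s ≢ p → s ≢ suc p → displacementWeight (s ∸ p) ≡ + 0
  displacementWeight-far {zero} {zero} _ s≢p _ = ⊥-elim (s≢p refl)
  displacementWeight-far {zero} {suc zero} _ _ s≢p+1 = ⊥-elim (s≢p+1 refl)
  displacementWeight-far {zero} {suc (suc s)} _ _ _ = refl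
  displacementWeight-far {suc p} {suc s} (s≤s p≤s) s≢p s≢p+1 =
    displacementWeight-far p≤s (s≢p ∘ cong suc) (s≢p+1 ∘ cong suc)

  runWeight-∷ : ∀ d ds → runWeight (just (d ∷ ds)) ≡ displacementWeight d * runWeight (just ds)
  runWeight-∷ 0 ds = sym (ℤ.*-identityˡ _)
  runWeight-∷ 1 ds with allLe1 ds
  ... | true = refl
  ... | false = sym (ℤ.*-zeroʳ y)
  runWeight-∷ (suc (suc d)) ds = sym (ℤ.*-zeroˡ (runWeight (just ds)))

  weightAfterParking : Maybe (ℕ × Board) → ℕ → List ℕ → ℤ
  weightAfterParking nothing p π = + 0
  weightAfterParking (just (s , o)) p π = displacementWeight (s ∸ p) * runWeight (run o π)

  runWeight-run-∷ : ∀ occ p π → runWeight (run occ (p ∷ π)) ≡ weightAfterParking (park occ p) p π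
  runWeight-run-∷ occ p π with park occ p
  ... | nothing = refl
  ... | just (s , o) with run o π
  ...   | nothing = sym (ℤ.*-zeroʳ (displacementWeight (s ∸ p)))
  ...   | just ds = runWeight-∷ (s ∸ p) ds

  bumpWeight : Bool → ℤ
  bumpWeight true = y
  bumpWeight false = + 0

  stepWeight : Board → ℕ → ℤ
  stepWeight occ zero = + 1
  stepWeight occ (suc f) = + 1 + bumpWeight (occ ! f)

  completions : ℕ → Board → ℤ
  completions zero occ = + 1
  completions (suc k) occ =
    ∑< (length occ) (λ f → whenFree (occ ! f) (stepWeight occ f * completions k (fill occ f)))

  fillWeight : ℕ → Board → ℕ → ℤ
  fillWeight k occ f = whenFree (occ ! f) (completions k (fill occ f))

  firstCarWeight : ℕ → Maybe (ℕ × Board) → ℕ → ℤ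
  firstCarWeight k nothing p = + 0
  firstCarWeight k (just (s , o)) p = displacementWeight (s ∸ p) * completions k o

  firstCarWeight-park : ∀ k occ p →
    firstCarWeight k (park occ p) p ≡ fillWeight k occ p + bumpWeight (occ ! p) * fillWeight k occ (suc p)
  firstCarWeight-park k occ p with occ ! p in p-occ
  ... | false rewrite park-free occ p-occ | ℕ.n∸n≡0 p =
    trans (ℤ.*-identityˡ _) (sym (ℤ.+-identityʳ _))
  ... | true with occ ! suc p in p+1-occ
  ...   | false rewrite park-next occ p-occ p+1-occ | ℕ.m+n∸n≡m 1 p = sym (ℤ.+-identityˡ _)
  ...   | true with park occ p in parked
  ...     | nothing = sym (trans (ℤ.+-identityˡ _) (ℤ.*-zeroʳ y))
  ...     | just (s , o) with park-spec occ p parked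
  ...       | s-free , p≤s , _ =
    begin
      displacementWeight (s ∸ p) * completions k o
    ≡⟨ cong (_* completions k o) (displacementWeight-far p≤s s≢p s≢p+1) ⟩
      + 0 * completions k o
    ≡⟨ ℤ.*-zeroˡ (completions k o) ⟩
      + 0
    ≡⟨ sym (trans (ℤ.+-identityˡ _) (ℤ.*-zeroʳ y)) ⟩
      + 0 + y * + 0
    ∎
    where
    open ≡-Reasoning
    s≢p : s ≢ p
    s≢p s≡p = !-occupied≢free occ p-occ s-free (sym s≡p)
    s≢p+1 : s ≢ suc p
    s≢p+1 s≡p+1 = !-occupied≢free occ p+1-occ s-free (sym s≡p+1)

  whenFree-stepWeight : ∀ b c t → whenFree b ((+ 1 + c) * t) ≡ whenFree b t + c * whenFree b t
  whenFree-stepWeight true c t = sym (trans (ℤ.+-identityˡ _) (ℤ.*-zeroʳ c))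
  whenFree-stepWeight false c t = expand c t
    where
    expand : ∀ c t → (+ 1 + c) * t ≡ t + c * t
    expand = solve-∀

  completions-by-first-car : ∀ k occ →
    completions (suc k) occ ≡ ∑< (length occ) (λ p → firstCarWeight k (park occ p) p)
  completions-by-first-car k [] = refl
  completions-by-first-car k occ@(_ ∷ bs) = begin
      ∑< (suc m) move
    ≡⟨ ∑<-cong′ (suc m) move-split ⟩
      ∑< (suc m) (λ f → A f + shiftRight Bumped f)
    ≡⟨ ∑<-distrib-+ (suc m) A (shiftRight Bumped) ⟩
      ∑< (suc m) A + ∑< (suc m) (shiftRight Bumped)
    ≡⟨ cong (_+_ (∑< (suc m) A)) (∑<-shiftRight m Bumped last-unbumped) ⟩
      ∑< (suc m) A + ∑< (suc m) Bumped
    ≡⟨ sym (∑<-distrib-+ (suc m) A Bumped) ⟩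
      ∑< (suc m) (λ p → A p + Bumped p)
    ≡⟨ sym (∑<-cong′ (suc m) (firstCarWeight-park k occ)) ⟩
      ∑< (suc m) (λ p → firstCarWeight k (park occ p) p)
    ∎
    where
    open ≡-Reasoning
    m = length bs
    move : ℕ → ℤ
    move f = whenFree (occ ! f) (stepWeight occ f * completions k (fill occ f))
    A : ℕ → ℤ
    A = fillWeight k occ
    Bumped : ℕ → ℤ
    Bumped p = bumpWeight (occ ! p) * A (suc p)
    move-split : ∀ f → move f ≡ A f + shiftRight Bumped f
    move-split zero = trans (whenFree-cong (occ ! 0) (λ _ → ℤ.*-identityˡ _)) (sym (ℤ.+-identityʳ _))
    move-split (suc f) = whenFree-stepWeight (occ ! suc f) (bumpWeight (occ ! f)) _
    last-unbumped : Bumped m ≡ + 0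
    last-unbumped = trans (cong (bumpWeight (occ ! m) *_) (whenFree-occupied _ (!-beyond occ ℕ.≤-refl)))
                          (ℤ.*-zeroʳ (bumpWeight (occ ! m)))

  runWeights≡completions : ∀ k m occ → length occ ≡ m →
    sumℤ (map (runWeight ∘ run occ) (seqs m k)) ≡ completions k occ
  runWeights≡completions zero m occ len≡m = refl
  runWeights≡completions (suc k) m occ len≡m = begin
      sumℤ (map (runWeight ∘ run occ) (seqs m (suc k)))
    ≡⟨ sumℤ-seqs-suc (runWeight ∘ run occ) m k ⟩
      ∑< m (λ p → sumℤ (map (runWeight ∘ run occ ∘ (p ∷_)) (seqs m k)))
    ≡⟨ ∑<-cong′ m (λ p → trans (sumℤ-map-cong (runWeight-run-∷ occ p) (seqs m k)) (first-car p)) ⟩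
      ∑< m (λ p → firstCarWeight k (park occ p) p)
    ≡⟨ cong (λ l → ∑< l (λ p → firstCarWeight k (park occ p) p)) (sym len≡m) ⟩
      ∑< (length occ) (λ p → firstCarWeight k (park occ p) p)
    ≡⟨ sym (completions-by-first-car k occ) ⟩
      completions (suc k) occ
    ∎
    where
    open ≡-Reasoning
    first-car : ∀ p → sumℤ (map (weightAfterParking (park occ p) p) (seqs m k)) ≡ firstCarWeight k (park occ p) p
    first-car p with park occ p in parked
    ... | nothing = sumℤ-map-zero (seqs m k)
    ... | just (s , o) with park-spec occ p parked
    ...   | _ , _ , len-o =
      trans (sym (*-distribˡ-sumℤ-map (displacementWeight (s ∸ p)) (runWeight ∘ run o) (seqs m k)))
            (cong (displacementWeight (s ∸ p) *_) (runWeights≡completions k m o (trans len-o len≡m)))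

  -- Decomposition by the spot the last car fills

  -- The last car to park finds every other spot occupied.
  lastWeight : ℕ → ℤ
  lastWeight zero = + 1
  lastWeight (suc _) = + 1 + y

  stepWeight-last : ∀ occ f → #free (take f occ) ≡ 0 → stepWeight occ f ≡ lastWeight f
  stepWeight-last occ zero _ = refl
  stepWeight-last occ (suc f) full = cong (λ b → + 1 + bumpWeight b)
    (trans (sym (take-! occ (ℕ.n<1+n f))) (#free≡0⇒occupied (take (suc f) occ) full))

  stepWeight-take : ∀ occ {e f} → f < e → stepWeight occ f ≡ stepWeight (take e occ) f
  stepWeight-take occ {f = zero} _ = refl
  stepWeight-take occ {f = suc f} f<e = cong (λ b → + 1 + bumpWeight b) (sym (take-! occ (ℕ.<⇒≤ f<e)))

  stepWeight-drop : ∀ occ {e} g → occ ! e ≡ false →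
    stepWeight occ (suc e ℕ.+ g) ≡ stepWeight (drop (suc e) occ) g
  stepWeight-drop occ {e} zero e-free =
    cong (λ b → + 1 + bumpWeight b) (trans (cong (occ !_) (ℕ.+-identityʳ e)) e-free)
  stepWeight-drop occ {e} (suc g) e-free =
    cong (λ b → + 1 + bumpWeight b) (trans (cong (occ !_) (ℕ.+-suc e g)) (sym (drop-! occ e g)))

  -- Cars parking in L and in R do not interact while the spot between them is
  -- empty; the binomial coefficient counts the interleavings of the two streams.
  interleavings : Board → Board → ℤ
  interleavings L R =
    + ((#free L ℕ.+ #free R) C #free L) * completions (#free L) L * completions (#free R) R

  interleavings-≡ : ∀ L R {a b} → #free L ≡ a → #free R ≡ b →
    interleavings L R ≡ + ((a ℕ.+ b) C a) * completions a L * completions b R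
  interleavings-≡ L R refl refl = refl

  leftMove : Board → Board → ℕ → ℤ
  leftMove L R f = whenFree (L ! f) (stepWeight L f * interleavings (fill L f) R)

  rightMove : Board → Board → ℕ → ℤ
  rightMove L R g = whenFree (R ! g) (stepWeight R g * interleavings L (fill R g))


  ∑-leftMove-suc : ∀ L R {a b} → #free L ≡ suc a → #free R ≡ b →
    ∑< (length L) (leftMove L R) ≡ + ((a ℕ.+ b) C a) * completions (suc a) L * completions b R
  ∑-leftMove-suc L R {a} {b} hL hR = begin
      ∑< (length L) (leftMove L R)
    ≡⟨ ∑<-cong′ (length L) factor ⟩
      ∑< (length L) (λ f → K * whenFree (L ! f) (stepWeight L f * completions a (fill L f)))
    ≡⟨ sym (*-distribˡ-∑< (length L) K (λ f → whenFree (L ! f) (stepWeight L f * completions a (fill L f)))) ⟩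
      K * completions (suc a) L
    ≡⟨ reorder (+ ((a ℕ.+ b) C a)) (completions b R) (completions (suc a) L) ⟩
      + ((a ℕ.+ b) C a) * completions (suc a) L * completions b R
    ∎
    where
    open ≡-Reasoning
    K = + ((a ℕ.+ b) C a) * completions b R
    reorder : ∀ c r l → (c * r) * l ≡ c * l * r
    reorder = solve-∀
    factor : ∀ f → leftMove L R f ≡ K * whenFree (L ! f) (stepWeight L f * completions a (fill L f))
    factor f = trans (whenFree-cong (L ! f) moved) (sym (*-distribˡ-whenFree (L ! f) K _))
      where
      shuffle : ∀ w c l r → w * (c * l * r) ≡ (c * r) * (w * l)
      shuffle = solve-∀
      moved : L ! f ≡ false →
        stepWeight L f * interleavings (fill L f) R ≡ K * (stepWeight L f * completions a (fill L f))
      moved f-free = trans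
        (cong (stepWeight L f *_) (interleavings-≡ (fill L f) R (ℕ.suc-injective (trans (sym (#free-fill L f-free)) hL)) hR))
        (shuffle (stepWeight L f) (+ ((a ℕ.+ b) C a)) (completions a (fill L f)) (completions b R))

  ∑-rightMove-suc : ∀ L R {a b} → #free L ≡ a → #free R ≡ suc b →
    ∑< (length R) (rightMove L R) ≡ + ((a ℕ.+ b) C a) * completions a L * completions (suc b) R
  ∑-rightMove-suc L R {a} {b} hL hR = begin
      ∑< (length R) (rightMove L R)
    ≡⟨ ∑<-cong′ (length R) factor ⟩
      ∑< (length R) (λ g → K * whenFree (R ! g) (stepWeight R g * completions b (fill R g)))
    ≡⟨ sym (*-distribˡ-∑< (length R) K (λ g → whenFree (R ! g) (stepWeight R g * completions b (fill R g)))) ⟩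
      K * completions (suc b) R
    ∎
    where
    open ≡-Reasoning
    K = + ((a ℕ.+ b) C a) * completions a L
    factor : ∀ g → rightMove L R g ≡ K * whenFree (R ! g) (stepWeight R g * completions b (fill R g))
    factor g = trans (whenFree-cong (R ! g) moved) (sym (*-distribˡ-whenFree (R ! g) K _))
      where
      shuffle : ∀ w c l r → w * (c * l * r) ≡ (c * l) * (w * r)
      shuffle = solve-∀
      moved : R ! g ≡ false →
        stepWeight R g * interleavings L (fill R g) ≡ K * (stepWeight R g * completions b (fill R g))
      moved g-free = trans
        (cong (stepWeight R g *_) (interleavings-≡ L (fill R g) hL (ℕ.suc-injective (trans (sym (#free-fill R g-free)) hR))))
        (shuffle (stepWeight R g) (+ ((a ℕ.+ b) C a)) (completions a L) (completions b (fill R g)))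

  interleavings-step : ∀ L R {k} → #free L ℕ.+ #free R ≡ suc k →
    interleavings L R ≡ ∑< (length L) (leftMove L R) + ∑< (length R) (rightMove L R)
  interleavings-step L R = byFreeCounts (#free L) (#free R) refl refl
    where
    open ≡-Reasoning
    byFreeCounts : ∀ a b {k} → #free L ≡ a → #free R ≡ b → a ℕ.+ b ≡ suc k →
      interleavings L R ≡ ∑< (length L) (leftMove L R) + ∑< (length R) (rightMove L R)
    byFreeCounts zero zero hL hR ()
    byFreeCounts zero (suc b) hL hR _ = begin
        interleavings L R
      ≡⟨ interleavings-≡ L R hL hR ⟩
        + 1 * completions 0 L * completions (suc b) R
      ≡⟨ sym (ℤ.+-identityˡ _) ⟩
        + 0 + + 1 * completions 0 L * completions (suc b) R
      ≡⟨ sym (cong₂ _+_ (∑<-whenFree-full L (length L) (λ f → stepWeight L f * interleavings (fill L f) R) hL) (∑-rightMove-suc L R hL hR)) ⟩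
        ∑< (length L) (leftMove L R) + ∑< (length R) (rightMove L R)
      ∎
    byFreeCounts (suc a) zero hL hR _ = begin
        interleavings L R
      ≡⟨ interleavings-≡ L R hL hR ⟩
        + ((suc a ℕ.+ 0) C suc a) * completions (suc a) L * completions 0 R
      ≡⟨ cong (λ c → + c * completions (suc a) L * completions 0 R) (trans (nC[n+0]≡1 (suc a)) (sym (nC[n+0]≡1 a))) ⟩
        + ((a ℕ.+ 0) C a) * completions (suc a) L * completions 0 R
      ≡⟨ sym (ℤ.+-identityʳ _) ⟩
        + ((a ℕ.+ 0) C a) * completions (suc a) L * completions 0 R + + 0
      ≡⟨ sym (cong₂ _+_ (∑-leftMove-suc L R hL hR) (∑<-whenFree-full R (length R) (λ g → stepWeight R g * interleavings L (fill R g)) hR)) ⟩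
        ∑< (length L) (leftMove L R) + ∑< (length R) (rightMove L R)
      ∎
      where
      nC[n+0]≡1 : ∀ n → (n ℕ.+ 0) C n ≡ 1
      nC[n+0]≡1 n = trans (cong (_C n) (ℕ.+-identityʳ n)) (nCn≡1 n)
    byFreeCounts (suc a) (suc b) hL hR _ = begin
        interleavings L R
      ≡⟨ interleavings-≡ L R hL hR ⟩
        + ((suc a ℕ.+ suc b) C suc a) * tL * tR
      ≡⟨ cong (λ c → + c * tL * tR) (sym pascal) ⟩
        + ((a ℕ.+ suc b) C a ℕ.+ (suc a ℕ.+ b) C suc a) * tL * tR
      ≡⟨ cong (λ c → c * tL * tR) (ℤ.pos-+ ((a ℕ.+ suc b) C a) ((suc a ℕ.+ b) C suc a)) ⟩
        (+ ((a ℕ.+ suc b) C a) + + ((suc a ℕ.+ b) C suc a)) * tL * tR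
      ≡⟨ distrib (+ ((a ℕ.+ suc b) C a)) (+ ((suc a ℕ.+ b) C suc a)) tL tR ⟩
        + ((a ℕ.+ suc b) C a) * tL * tR + + ((suc a ℕ.+ b) C suc a) * tL * tR
      ≡⟨ sym (cong₂ _+_ (∑-leftMove-suc L R hL hR) (∑-rightMove-suc L R hL hR)) ⟩
        ∑< (length L) (leftMove L R) + ∑< (length R) (rightMove L R)
      ∎
      where
      tL = completions (suc a) L
      tR = completions (suc b) R
      pascal : (a ℕ.+ suc b) C a ℕ.+ (suc a ℕ.+ b) C suc a ≡ (suc a ℕ.+ suc b) C suc a
      pascal = trans (cong (λ n → (a ℕ.+ suc b) C a ℕ.+ n C suc a) (sym (ℕ.+-suc a b)))
                     (nCk+nC[k+1]≡[n+1]C[k+1] (a ℕ.+ suc b) a)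
      distrib : ∀ c d l r → (c + d) * l * r ≡ c * l * r + d * l * r
      distrib = solve-∀

  movesAround : Board → ℕ → ℕ → ℤ
  movesAround occ e f =
    whenFree (occ ! f) (whenFree (fill occ f ! e)
      (stepWeight occ f * interleavings (take e (fill occ f)) (drop (suc e) (fill occ f))))

  movesAround-left : ∀ occ {e f} → occ ! e ≡ false → f < e →
    movesAround occ e f ≡ leftMove (take e occ) (drop (suc e) occ) f
  movesAround-left occ {e} {f} e-free f<e
    rewrite sym (take-! occ f<e) | fill-!-other occ (ℕ.<⇒≢ f<e) | e-free
          | take-fill-< occ f<e | drop-fill-≤ occ (ℕ.<⇒≤ f<e) | stepWeight-take occ f<e = refl

  movesAround-middle : ∀ occ {e} → occ ! e ≡ false → movesAround occ e e ≡ + 0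
  movesAround-middle occ {e} e-free rewrite e-free | fill-!-same occ e = refl

  movesAround-right : ∀ occ {e} g → occ ! e ≡ false →
    movesAround occ e (suc e ℕ.+ g) ≡ rightMove (take e occ) (drop (suc e) occ) g
  movesAround-right occ {e} g e-free
    rewrite sym (drop-! occ e g) | fill-!-other occ {suc e ℕ.+ g} {e} (ℕ.<⇒≢ (s≤s (ℕ.m≤m+n e g)) ∘ sym) | e-free
          | take-fill-≥ occ {e} {suc e ℕ.+ g} (ℕ.≤-trans (ℕ.n≤1+n e) (ℕ.m≤m+n (suc e) g))
          | drop-fill-> occ e g | stepWeight-drop occ g e-free = refl

  ∑-movesAround : ∀ occ {e} → occ ! e ≡ false →
    ∑< (length occ) (movesAround occ e)
      ≡ ∑< (length (take e occ)) (leftMove (take e occ) (drop (suc e) occ))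
        + ∑< (length (drop (suc e) occ)) (rightMove (take e occ) (drop (suc e) occ))
  ∑-movesAround occ {e} e-free = begin
      ∑< (length occ) Z
    ≡⟨ cong (λ l → ∑< l Z) (length-around occ e<len) ⟩
      ∑< (e ℕ.+ suc r) Z
    ≡⟨ ∑<-around e r Z ⟩
      ∑< e Z + (Z e + ∑< r (λ g → Z (suc e ℕ.+ g)))
    ≡⟨ cong₂ _+_ left (cong₂ _+_ (movesAround-middle occ e-free) right) ⟩
      ∑< (length L) (leftMove L R) + (+ 0 + ∑< r (rightMove L R))
    ≡⟨ cong (_+_ (∑< (length L) (leftMove L R))) (ℤ.+-identityˡ _) ⟩
      ∑< (length L) (leftMove L R) + ∑< r (rightMove L R)
    ∎
    where
    open ≡-Reasoning
    e<len = free⇒<length occ e-free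
    Z = movesAround occ e
    L = take e occ
    R = drop (suc e) occ
    r = length R
    left : ∑< e Z ≡ ∑< (length L) (leftMove L R)
    left = trans (∑<-cong e (λ f f<e → movesAround-left occ e-free f<e))
                 (cong (λ l → ∑< l (leftMove L R)) (sym (length-take-≤ occ (ℕ.<⇒≤ e<len))))
    right : ∑< r (λ g → Z (suc e ℕ.+ g)) ≡ ∑< r (rightMove L R)
    right = ∑<-cong′ r (λ g → movesAround-right occ g e-free)

  lastSpot : Board → ℕ → ℤ
  lastSpot occ e = whenFree (occ ! e) (lastWeight e * interleavings (take e occ) (drop (suc e) occ))

  lastSpot-sole-free : ∀ occ {f} → #free occ ≡ 1 → occ ! f ≡ false →
    stepWeight occ f * + 1 ≡ lastWeight f * interleavings (take f occ) (drop (suc f) occ)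
  lastSpot-sole-free occ {f} one-free f-free = begin
      stepWeight occ f * + 1
    ≡⟨ ℤ.*-identityʳ _ ⟩
      stepWeight occ f
    ≡⟨ stepWeight-last occ f hL ⟩
      lastWeight f
    ≡⟨ sym (ℤ.*-identityʳ _) ⟩
      lastWeight f * + 1
    ≡⟨ cong (lastWeight f *_) (sym (interleavings-≡ L R hL hR)) ⟩
      lastWeight f * interleavings L R
    ∎
    where
    open ≡-Reasoning
    L = take f occ
    R = drop (suc f) occ
    none-free : #free L ℕ.+ #free R ≡ 0
    none-free = ℕ.suc-injective (trans (sym (#free-split occ f-free)) one-free)
    hL : #free L ≡ 0
    hL = ℕ.m+n≡0⇒m≡0 (#free L) none-free
    hR : #free R ≡ 0
    hR = ℕ.m+n≡0⇒n≡0 (#free L) none-free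

  ∑-firstCar-lastSpot : ∀ occ {k} e → #free occ ≡ suc (suc k) →
    ∑< (length occ) (λ f → whenFree (occ ! f) (stepWeight occ f * lastSpot (fill occ f) e)) ≡ lastSpot occ e
  ∑-firstCar-lastSpot occ {k} e free≡ = byOccupancy (occ ! e) refl
    where
    open ≡-Reasoning
    n = length occ
    L = take e occ
    R = drop (suc e) occ
    afterFill : ℕ → ℤ
    afterFill f = interleavings (take e (fill occ f)) (drop (suc e) (fill occ f))
    byOccupancy : ∀ b → occ ! e ≡ b →
      ∑< n (λ f → whenFree (occ ! f) (stepWeight occ f * lastSpot (fill occ f) e)) ≡ lastSpot occ e
    byOccupancy true e-occ = begin
        ∑< n (λ f → whenFree (occ ! f) (stepWeight occ f * lastSpot (fill occ f) e))
      ≡⟨ ∑<-cong′ n (λ f → trans (cong (λ t → whenFree (occ ! f) (stepWeight occ f * t))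
                                      (whenFree-occupied (lastWeight e * afterFill f) (fill-!-occupied occ f e-occ)))
                                (*-whenFree-zero (occ ! f) (stepWeight occ f))) ⟩
        ∑< n (λ _ → + 0)
      ≡⟨ ∑<-zero n ⟩
        + 0
      ≡⟨ sym (whenFree-occupied _ e-occ) ⟩
        lastSpot occ e
      ∎
    byOccupancy false e-free = begin
        ∑< n (λ f → whenFree (occ ! f) (stepWeight occ f * lastSpot (fill occ f) e))
      ≡⟨ ∑<-cong′ n (λ f → whenFree²-*-swap (occ ! f) (fill occ f ! e) (stepWeight occ f) (lastWeight e) (afterFill f)) ⟩
        ∑< n (λ f → lastWeight e * movesAround occ e f)
      ≡⟨ sym (*-distribˡ-∑< n (lastWeight e) (movesAround occ e)) ⟩
        lastWeight e * ∑< n (movesAround occ e)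
      ≡⟨ cong (lastWeight e *_) (∑-movesAround occ e-free) ⟩
        lastWeight e * (∑< (length L) (leftMove L R) + ∑< (length R) (rightMove L R))
      ≡⟨ cong (lastWeight e *_) (sym (interleavings-step L R (ℕ.suc-injective (trans (sym (#free-split occ e-free)) free≡)))) ⟩
        lastWeight e * interleavings L R
      ≡⟨ sym (whenFree-free _ e-free) ⟩
        lastSpot occ e
      ∎

  completions-by-last-spot : ∀ k occ → #free occ ≡ suc k →
    completions (suc k) occ ≡ ∑< (length occ) (lastSpot occ)
  completions-by-last-spot zero occ one-free =
    ∑<-cong′ (length occ) (λ f → whenFree-cong (occ ! f) (lastSpot-sole-free occ one-free))
  completions-by-last-spot (suc k) occ free≡ = begin
      completions (suc (suc k)) occ
    ≡⟨ ∑<-cong′ n expand ⟩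
      ∑< n (λ f → ∑< n (Y f))
    ≡⟨ ∑<-comm n n Y ⟩
      ∑< n (λ e → ∑< n (λ f → Y f e))
    ≡⟨ ∑<-cong′ n (λ e → ∑-firstCar-lastSpot occ e free≡) ⟩
      ∑< n (lastSpot occ)
    ∎
    where
    open ≡-Reasoning
    n = length occ
    Y : ℕ → ℕ → ℤ
    Y f e = whenFree (occ ! f) (stepWeight occ f * lastSpot (fill occ f) e)
    byInduction : ∀ f → occ ! f ≡ false → completions (suc k) (fill occ f) ≡ ∑< n (lastSpot (fill occ f))
    byInduction f f-free =
      trans (completions-by-last-spot k (fill occ f) (ℕ.suc-injective (trans (sym (#free-fill occ f-free)) free≡)))
            (cong (λ l → ∑< l (lastSpot (fill occ f))) (length-fill occ f))
    expand : ∀ f → whenFree (occ ! f) (stepWeight occ f * completions (suc k) (fill occ f)) ≡ ∑< n (Y f)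
    expand f = begin
        whenFree (occ ! f) (stepWeight occ f * completions (suc k) (fill occ f))
      ≡⟨ whenFree-cong (occ ! f) (cong (stepWeight occ f *_) ∘ byInduction f) ⟩
        whenFree (occ ! f) (stepWeight occ f * ∑< n (lastSpot (fill occ f)))
      ≡⟨ cong (whenFree (occ ! f)) (*-distribˡ-∑< n (stepWeight occ f) (lastSpot (fill occ f))) ⟩
        whenFree (occ ! f) (∑< n (λ e → stepWeight occ f * lastSpot (fill occ f) e))
      ≡⟨ whenFree-∑< (occ ! f) n (λ e → stepWeight occ f * lastSpot (fill occ f) e) ⟩
        ∑< n (Y f)
      ∎

  weight≡runWeight : ∀ n π → weight n y π ≡ runWeight (displacements n π)
  weight≡runWeight n π with displacements n π
  ... | nothing = refl
  ... | just ds = refl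

  P≡completions : ∀ n → P n y ≡ completions n (empty n)
  P≡completions n = trans (sumℤ-map-cong (weight≡runWeight n) (seqs n n))
                          (runWeights≡completions n n (empty n) (List.length-replicate n))

  lastSpot-empty : ∀ {n e} → e ≤ n →
    lastSpot (empty (suc n)) e ≡ lastWeight e * (+ (n C e) * P e y * P (n ∸ e) y)
  lastSpot-empty {n} {e} e≤n = begin
      lastSpot (empty (suc n)) e
    ≡⟨ whenFree-free _ (empty-! (s≤s e≤n)) ⟩
      lastWeight e * interleavings (take e (empty (suc n))) (drop e (empty n))
    ≡⟨ cong₂ (λ L R → lastWeight e * interleavings L R) (take-empty (ℕ.m≤n⇒m≤1+n e≤n)) (drop-empty n e) ⟩
      lastWeight e * interleavings (empty e) (empty (n ∸ e))
    ≡⟨ cong (lastWeight e *_) (interleavings-≡ (empty e) (empty (n ∸ e)) (#free-empty e) (#free-empty (n ∸ e))) ⟩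
      lastWeight e * (+ ((e ℕ.+ (n ∸ e)) C e) * completions e (empty e) * completions (n ∸ e) (empty (n ∸ e)))
    ≡⟨ cong (λ m → lastWeight e * (+ (m C e) * completions e (empty e) * completions (n ∸ e) (empty (n ∸ e))))
            (ℕ.m+[n∸m]≡n e≤n) ⟩
      lastWeight e * (+ (n C e) * completions e (empty e) * completions (n ∸ e) (empty (n ∸ e)))
    ≡⟨ sym (cong₂ (λ p q → lastWeight e * (+ (n C e) * p * q)) (P≡completions e) (P≡completions (n ∸ e))) ⟩
      lastWeight e * (+ (n C e) * P e y * P (n ∸ e) y)
    ∎
    where open ≡-Reasoning

theorem5p9 : ∀ (n : ℕ) (y : ℤ) →
    P (suc n) y ≡
      (y + + 1) * sumℤ (map (λ i → + (n C i) * P i y * P (n ∸ i) y) (upTo (suc n)))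
        - y * P n y
theorem5p9 n y = begin
    P (suc n) y
  ≡⟨ P≡completions (suc n) ⟩
    completions (suc n) (empty (suc n))
  ≡⟨ completions-by-last-spot n (empty (suc n)) (#free-empty (suc n)) ⟩
    ∑< (length (empty (suc n))) (lastSpot (empty (suc n)))
  ≡⟨ cong (λ l → ∑< l (lastSpot (empty (suc n)))) (List.length-replicate (suc n)) ⟩
    ∑< (suc n) (lastSpot (empty (suc n)))
  ≡⟨ ∑<-cong (suc n) (λ { e (s≤s e≤n) → lastSpot-empty e≤n }) ⟩
    + 1 * X 0 + ∑< n (λ e → (+ 1 + y) * X (suc e))
  ≡⟨ cong (_+_ (+ 1 * X 0)) (sym (*-distribˡ-∑< n (+ 1 + y) (X ∘ suc))) ⟩
    + 1 * X 0 + (+ 1 + y) * ∑< n (X ∘ suc)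
  ≡⟨ rearrange (X 0) (∑< n (X ∘ suc)) y ⟩
    (y + + 1) * ∑< (suc n) X - y * X 0
  ≡⟨ cong₂ (λ s x → (y + + 1) * s - y * x) (sym (sumℤ-map-upTo X (suc n))) (ℤ.*-identityˡ (P n y)) ⟩
    (y + + 1) * sumℤ (map X (upTo (suc n))) - y * P n y
  ∎
  where
  open ≡-Reasoning
  open Weighted y
  X : ℕ → ℤ
  X i = + (n C i) * P i y * P (n ∸ i) y
  rearrange : ∀ x s y → + 1 * x + (+ 1 + y) * s ≡ (y + + 1) * (x + s) - y * x
  rearrange = solve-∀
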